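{- Let $(G,\mathcal M)$ be a tensor network (with no open legs). A parallel algorithm can contract $(G,\mathcal M)$ in time $$\min_{(T,b)} \max_{l} \sum_{t} 2^{\mathrm{con}(t)},$$ where the minimum is over rooted contraction trees $(T,b)$ of $G$, the maximum is over leaves $l$ of $T$, and the sum is over the vertices $t$ of $T$ on the unique path from $l$ to the root $r$. In other words, the time is the minimum vertex-weighted height of a rooted contraction tree, where vertex $t$ has weight $2^{\mathrm{con}(t)}$. If the contraction is done as matrix multiplications performed in parallel, this bound is tight.
   Context: A tensor network $(G,\mathcal M)$ consists of a finite undirected graph $G$ with positive integer edge weights $w$ and, for each vertex $v$, a complex tensor $\mathbf M_v$ with one index per incident edge, the index for edge $e$ ranging over $[2^{w(e)}]$. Every edge joins two tensors. Contracting two tensors (original or produced by earlier contractions) sums over their shared indices and yields one tensor carrying the remaining indices. Cost model: contracting a tensor with index groups of dimensions $(d_L,d_M)$ with one of dimensions $(d_M,d_R)$ along $d_M$ (a matrix multiplication) takes time $d_L d_M d_R$; reading an initial tensor takes time equal to its number of entries. In the parallel model, contractions of disjoint sets of tensors may be carried out simultaneously; communication costs are ignored. A rooted contraction tree $(T,b)$ of $G$ is a tree $T$ with a designated leaf $r$ (the root), all other vertices of degree $1$ or $3$, together with a bijection $b$ from $V(G)$ to the non-root leaves of $T$; each internal vertex represents the contraction of the two tensors produced by the two subtrees below it. For an edge $\{u,v\}\in E(G)$, its routing is the unique path in $T$ between $b(u)$ and $b(v)$. The congestion $\mathrm{con}(t)$ of a vertex $t\in V(T)$ is the total weight of edges of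 $G$ whose routings contain $t$. -}

module Defs where

open import Data.Nat using (ℕ; zero; suc; _+_; _*_; _^_; _⊔_; _<ᵇ_)
open import Data.Fin using (Fin; toℕ; _≟_)
open import Data.List using (List; []; _∷_; map; foldr; allFin; filter; inits; concatMap; _++_)
open import Data.Nat.ListAction using (sum; product)
open import Data.Bool.ListAction using (any)
open import Data.Bool using (Bool; true; false; _∧_; _∨_; not; if_then_else_)
open import Data.Product using (_×_; _,_; proj₁; proj₂)
open import Relation.Binary.PropositionalEquality using (_≡_)
open import Data.List.Relation.Binary.Permutation.Propositional using (_↭_)
open import Relation.Nullary.Decidable using (⌊_⌋)

-- Weighted graphs on vertex set Fin n.
-- w u v = 0 means "no edge between u and v"; w u v = k > 0 means an
-- edge {u,v} of (positive integer) weight k.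
-- No open legs: every edge joins two (distinct) tensors.

record WGraph (n : ℕ) : Set where
  field
    w      : Fin n → Fin n → ℕ
    w-sym  : ∀ u v → w u v ≡ w v u
    w-loop : ∀ v → w v v ≡ 0

-- A rooted contraction tree is a tree whose non-root vertices have degree
-- 1 or 3, with a designated root leaf r.  Removing r and orienting away
-- from it, the rest is a full binary tree whose leaves are labelled by
-- the vertices of G (the map b).  We represent that binary tree
-- inductively; the root leaf r is the (implicit) extra leaf attached
-- above the top vertex.

data CTree (n : ℕ) : Set where
  leaf : Fin n → CTree n
  node : CTree n → CTree n → CTree n

leaves : ∀ {n} → CTree n → List (Fin n)
leaves (leaf v)   = v ∷ []
leaves (node l r) = leaves l ++ leaves r

-- b is a bijection from V(G) onto the non-root leaves of T
IsContractionTree : ∀ {n} → CTree n → Set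
IsContractionTree {n} T = leaves T ↭ allFin n

-- Positions of vertices of T (other than r): the list of directions from
-- the top vertex (the neighbour of r) down to the vertex.
data Dir : Set where
  left right : Dir

Pos : Set
Pos = List Dir

data TVertex : Set where
  rootLeaf : TVertex
  at       : Pos → TVertex

leafPositions : ∀ {n} → CTree n → List (Fin n × Pos)
leafPositions (leaf v)   = (v , []) ∷ []
leafPositions (node l r) =
  map (λ vp → proj₁ vp , left ∷ proj₂ vp) (leafPositions l) ++
  map (λ vp → proj₁ vp , right ∷ proj₂ vp) (leafPositions r)

eqDir : Dir → Dir → Bool
eqDir left  left  = true
eqDir right right = true
eqDir _     _     = false

isPrefix : Pos → Pos → Bool
isPrefix []       _        = true
isPrefix (_ ∷ _)  []       = false
isPrefix (d ∷ p)  (e ∷ q)  = eqDir d e ∧ isPrefix p q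

-- longest common prefix = position of the lowest common ancestor
lcp : Pos → Pos → Pos
lcp (d ∷ p) (e ∷ q) = if eqDir d e then d ∷ lcp p q else []
lcp _       _       = []

lookupPos : ∀ {n} → List (Fin n × Pos) → Fin n → Pos
lookupPos []             v = []
lookupPos ((u , p) ∷ xs) v = if ⌊ u ≟ v ⌋ then p else lookupPos xs v

posOf : ∀ {n} → CTree n → Fin n → Pos
posOf T v = lookupPos (leafPositions T) v

-- does vertex t of T lie on the routing of {u,v}, i.e. on the unique path
-- in T between b(u) and b(v)?  That path consists of the ancestors of b(u)
-- and of b(v) (inclusive) which are descendants of their lowest common
-- ancestor (inclusive).
onRoute : ∀ {n} → CTree n → Fin n → Fin n → TVertex → Bool
onRoute T u v rootLeaf = false
onRoute T u v (at p) =
  isPrefix (lcp (posOf T u) (posOf T v)) p ∧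
  (isPrefix p (posOf T u) ∨ isPrefix p (posOf T v))

-- unordered pairs {u,v}, u ≠ v, each listed once (as toℕ u < toℕ v)
pairs : (n : ℕ) → List (Fin n × Fin n)
pairs n = filter (λ uv → toℕ (proj₁ uv) Data.Nat.<? toℕ (proj₂ uv))
                 (concatMap (λ u → map (λ v → u , v) (allFin n)) (allFin n))

-- congestion: total weight of edges whose routing contains t
-- (non-edges have w = 0 and contribute nothing)
con : ∀ {n} → (Fin n → Fin n → ℕ) → CTree n → TVertex → ℕ
con {n} w T t =
  sum (map (λ uv → if onRoute T (proj₁ uv) (proj₂ uv) t
                   then w (proj₁ uv) (proj₂ uv) else 0) (pairs n))

-- sum of 2^con(t) over the vertices t on the path from the leaf at
-- position p to the root r (the prefixes of p, plus r)
pathWeight : ∀ {n} → (Fin n → Fin n → ℕ) → CTree n → Pos → ℕ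
pathWeight w T p =
  2 ^ con w T rootLeaf + sum (map (λ q → 2 ^ con w T (at q)) (inits p))

-- max over all leaves l of T (including r itself, whose path is just r)
weightedHeight : ∀ {n} → (Fin n → Fin n → ℕ) → CTree n → ℕ
weightedHeight w T =
  foldr _⊔_ (2 ^ con w T rootLeaf)
        (map (λ vp → pathWeight w T (proj₂ vp)) (leafPositions T))

_∈ᵇ_ : ∀ {n} → Fin n → List (Fin n) → Bool
v ∈ᵇ xs = any (λ x → ⌊ x ≟ v ⌋) xs

-- number of entries of the initial tensor M_v: product of 2^{w(e)} over
-- the edges e incident to v
entries : ∀ {n} → (Fin n → Fin n → ℕ) → Fin n → ℕ
entries {n} w v = product (map (λ u → 2 ^ w v u) (allFin n))

-- product of 2^{w(a,b)} over a ∈ A, b ∈ B  (dimension of the index group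
-- of the edges between the disjoint vertex sets A and B)
dim : ∀ {n} → (Fin n → Fin n → ℕ) → List (Fin n) → List (Fin n) → ℕ
dim w A B = product (concatMap (λ a → map (λ b → 2 ^ w a b) B) A)

-- time of contracting the tensor of subtree l (vertex set A) with that of
-- subtree r (vertex set B): d_L d_M d_R where M = edges between A and B,
-- L = edges from A to outside A ∪ B, R = edges from B to outside A ∪ B.
matmulCost : ∀ {n} → (Fin n → Fin n → ℕ) → CTree n → CTree n → ℕ
matmulCost {n} w l r =
  dim w A C * dim w A B * dim w B C
  where
    A = leaves l
    B = leaves r
    C = filter (λ c → Relation.Nullary.Decidable.¬? (Data.Bool._≟_ (c ∈ᵇ A ∨ c ∈ᵇ B) true)) (allFin n)

-- parallel completion time of the tensor of a subtree: the two
-- sub-contractions run simultaneously, then one matrix multiplication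
finishTime : ∀ {n} → (Fin n → Fin n → ℕ) → CTree n → ℕ
finishTime w (leaf v)   = entries w v
finishTime w (node l r) = matmulCost w l r + (finishTime w l ⊔ finishTime w r)

-- total parallel time of the contraction algorithm given by T.  The final
-- step at the root leaf r outputs the resulting scalar (a tensor with no
-- indices, 2^0 = 1 entry), costing 1.
parallelTime : ∀ {n} → (Fin n → Fin n → ℕ) → CTree n → ℕ
parallelTime w T = finishTime w T + 1

module Submission where

-- Both bounds hold with T' = T: for every rooted contraction tree the parallel time equals the
-- weighted height.  At an internal vertex t whose subtrees have vertex sets L and R, with C the
-- remaining vertices, the matrix multiplication costs d_L d_M d_R = 2^(w(L,C) + w(L,R) + w(R,C)),
-- and the edges joining two of L, R, C are exactly those routed through t, so the cost is 2^con(t);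
-- likewise reading the tensor of v costs 2^deg(v) = 2^con(b(v)).  No routing contains the root
-- leaf r, so its weight 2^0 = 1 is the cost of the final output step.  As the two subtrees are
-- contracted in parallel, finishing times obey the recursion for the heaviest path up to the root.

open import Defs
open import Data.Bool using (Bool; true; false; _∧_; _∨_; not; if_then_else_)
import Data.Bool as Bool
open import Data.Bool.Properties using (∧-zeroʳ; if-eta)
open import Data.Empty using (⊥-elim)
open import Data.Fin using (Fin; toℕ; _≟_)
open import Data.Fin.Properties using (toℕ-injective)
open import Data.List using (List; []; _∷_; map; foldr; allFin; filter; inits; concatMap; _++_; _∷ʳ_)
open import Data.List.Properties using (++-assoc; ++-identityʳ; map-++; map-∘; map-cong)
open import Data.List.Membership.Propositional using (_∈_; _∉_)
open import Data.List.Membership.Propositional.Properties using (∈-++⁺ˡ; ∈-++⁺ʳ; ∈-++⁻; ∈-allFin)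
open import Data.List.Relation.Unary.All using (All; []; _∷_)
open import Data.List.Relation.Unary.All.Properties using (++⁻ˡ)
open import Data.List.Relation.Unary.Any using (here; there; tail)
open import Data.List.Relation.Unary.AllPairs using ([]; _∷_)
open import Data.List.Relation.Unary.Unique.Propositional using (Unique)
open import Data.List.Relation.Unary.Unique.Propositional.Properties using (allFin⁺; Unique[x∷xs]⇒x∉xs)
open import Data.List.Relation.Binary.Permutation.Propositional using (↭-sym; ↭⇒↭ₛ)
open import Data.List.Relation.Binary.Permutation.Propositional.Properties using (∈-resp-↭)
import Data.List.Relation.Binary.Permutation.Setoid.Properties as Permutationₛ
open import Data.Nat using (ℕ; _≤_; _+_; _*_; _^_; _⊔_; _<?_)
open import Data.Nat.Properties hiding (_≟_)
open import Algebra.Properties.CommutativeSemigroup +-commutativeSemigroup using (interchange)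
open import Data.Nat.ListAction using (sum; product)
open import Data.Nat.ListAction.Properties using (sum-++; product-++)
open import Data.Nat.Solver using (module +-*-Solver)
open import Data.Product using (Σ; ∃; ∃₂; _×_; _,_; proj₁; proj₂)
open import Data.Sum using (inj₁; inj₂)
open import Function using (_∘_)
open import Relation.Nullary using (yes; no; does)
open import Relation.Nullary.Decidable using (⌊_⌋; ¬?; dec-true; dec-false)
open import Relation.Unary using (Decidable)
open import Relation.Binary.Definitions using (tri<; tri≈; tri>)
open import Relation.Binary.PropositionalEquality
open ≡-Reasoning

private variable
  A B : Set
  f g : A → ℕ

∑ : List A → (A → ℕ) → ℕ
∑ xs f = sum (map f xs)

∑-cong : ∀ (xs : List A) → (∀ x → f x ≡ g x) → ∑ xs f ≡ ∑ xs g
∑-cong xs f≗g = cong sum (map-cong f≗g xs)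

∑-zero : ∀ (xs : List A) → ∑ xs (λ _ → 0) ≡ 0
∑-zero []       = refl
∑-zero (_ ∷ xs) = ∑-zero xs

∑-+ : ∀ (xs : List A) → ∑ xs (λ x → f x + g x) ≡ ∑ xs f + ∑ xs g
∑-+ []                     = refl
∑-+ {f = f} {g} (x ∷ xs) = begin
  f x + g x + ∑ xs (λ x → f x + g x)  ≡⟨ cong (f x + g x +_) (∑-+ xs) ⟩
  f x + g x + (∑ xs f + ∑ xs g)       ≡⟨ interchange (f x) (g x) (∑ xs f) (∑ xs g) ⟩
  f x + ∑ xs f + (g x + ∑ xs g)       ∎

∑-*ˡ : ∀ k (xs : List A) → ∑ xs (λ x → k * f x) ≡ k * ∑ xs f
∑-*ˡ k []               = sym (*-zeroʳ k)
∑-*ˡ {f = f} k (x ∷ xs) = begin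
  k * f x + ∑ xs (λ x → k * f x)  ≡⟨ cong (k * f x +_) (∑-*ˡ k xs) ⟩
  k * f x + k * ∑ xs f            ≡⟨ *-distribˡ-+ k (f x) (∑ xs f) ⟨
  k * (f x + ∑ xs f)              ∎

∑-map : ∀ (h : A → B) (xs : List A) {f : B → ℕ} → ∑ (map h xs) f ≡ ∑ xs (f ∘ h)
∑-map h xs = cong sum (sym (map-∘ xs))

∑-concatMap : ∀ (h : A → List B) (xs : List A) {f : B → ℕ} →
              ∑ (concatMap h xs) f ≡ ∑ xs (λ x → ∑ (h x) f)
∑-concatMap h []           = refl
∑-concatMap h (x ∷ xs) {f} = begin
  sum (map f (h x ++ concatMap h xs))          ≡⟨ cong sum (map-++ f (h x) (concatMap h xs)) ⟩
  sum (map f (h x) ++ map f (concatMap h xs))  ≡⟨ sum-++ (map f (h x)) (map f (concatMap h xs)) ⟩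
  ∑ (h x) f + ∑ (concatMap h xs) f             ≡⟨ cong (∑ (h x) f +_) (∑-concatMap h xs) ⟩
  ∑ (h x) f + ∑ xs (λ x → ∑ (h x) f)           ∎

∑-filter : ∀ {P : A → Set} (P? : Decidable P) (xs : List A) →
           ∑ (filter P? xs) f ≡ ∑ xs (λ x → if does (P? x) then f x else 0)
∑-filter P? []       = refl
∑-filter P? (x ∷ xs) with does (P? x)
... | true  = cong (_ +_) (∑-filter P? xs)
... | false = ∑-filter P? xs

∑-comm : ∀ (h : A → B → ℕ) xs ys → ∑ xs (λ x → ∑ ys (h x)) ≡ ∑ ys (λ y → ∑ xs (λ x → h x y))
∑-comm h []       ys = sym (∑-zero ys)
∑-comm h (x ∷ xs) ys = begin
  ∑ ys (h x) + ∑ xs (λ x → ∑ ys (h x))            ≡⟨ cong (∑ ys (h x) +_) (∑-comm h xs ys) ⟩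
  ∑ ys (h x) + ∑ ys (λ y → ∑ xs (λ x → h x y))    ≡⟨ ∑-+ ys ⟨
  ∑ ys (λ y → h x y + ∑ xs (λ x → h x y))         ∎

product-2^ : ∀ (xs : List A) → product (map (λ x → 2 ^ f x) xs) ≡ 2 ^ ∑ xs f
product-2^ []               = refl
product-2^ {f = f} (x ∷ xs) = begin
  2 ^ f x * product (map (λ x → 2 ^ f x) xs)  ≡⟨ cong (2 ^ f x *_) (product-2^ xs) ⟩
  2 ^ f x * 2 ^ ∑ xs f                        ≡⟨ ^-distribˡ-+-* 2 (f x) (∑ xs f) ⟨
  2 ^ (f x + ∑ xs f)                          ∎

𝟙 : Bool → ℕ
𝟙 true  = 1
𝟙 false = 0

if-then-0≡𝟙* : ∀ b k → (if b then k else 0) ≡ 𝟙 b * k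
if-then-0≡𝟙* true  k = sym (*-identityˡ k)
if-then-0≡𝟙* false k = refl

⨆ : List ℕ → ℕ
⨆ = foldr _⊔_ 0

⨆-++ : ∀ xs ys → ⨆ (xs ++ ys) ≡ ⨆ xs ⊔ ⨆ ys
⨆-++ []       ys = refl
⨆-++ (x ∷ xs) ys = trans (cong (x ⊔_) (⨆-++ xs ys)) (sym (⊔-assoc x (⨆ xs) (⨆ ys)))

⨆-map-+ : ∀ k (h : A → ℕ) x xs → ⨆ (map (λ y → k + h y) (x ∷ xs)) ≡ k + ⨆ (map h (x ∷ xs))
⨆-map-+ k h x []       = trans (⊔-identityʳ (k + h x)) (cong (k +_) (sym (⊔-identityʳ (h x))))
⨆-map-+ k h x (y ∷ xs) = begin
  (k + h x) ⊔ ⨆ (map (λ y → k + h y) (y ∷ xs))  ≡⟨ cong ((k + h x) ⊔_) (⨆-map-+ k h y xs) ⟩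
  (k + h x) ⊔ (k + ⨆ (map h (y ∷ xs)))         ≡⟨ +-distribˡ-⊔ k (h x) _ ⟨
  k + (h x ⊔ ⨆ (map h (y ∷ xs)))               ∎

foldr-⊔-1+ : ∀ (h : A → ℕ) xs → foldr _⊔_ 1 (map (λ x → 1 + h x) xs) ≡ ⨆ (map h xs) + 1
foldr-⊔-1+ h []       = refl
foldr-⊔-1+ h (x ∷ xs) = begin
  (1 + h x) ⊔ foldr _⊔_ 1 (map (λ x → 1 + h x) xs)  ≡⟨ cong₂ _⊔_ (+-comm 1 (h x)) (foldr-⊔-1+ h xs) ⟩
  (h x + 1) ⊔ (⨆ (map h xs) + 1)                     ≡⟨ +-distribʳ-⊔ 1 (h x) (⨆ (map h xs)) ⟨
  (h x ⊔ ⨆ (map h xs)) + 1                           ∎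

∉-++ : ∀ {v : A} xs ys → v ∉ xs → v ∉ ys → v ∉ xs ++ ys
∉-++ xs ys v∉xs v∉ys v∈ with ∈-++⁻ xs v∈
... | inj₁ v∈xs = v∉xs v∈xs
... | inj₂ v∈ys = v∉ys v∈ys

Unique-++⁻ˡ : ∀ (xs ys : List A) → Unique (xs ++ ys) → Unique xs
Unique-++⁻ˡ []       ys _          = []
Unique-++⁻ˡ (x ∷ xs) ys (x∉ ∷ xs!) = ++⁻ˡ xs x∉ ∷ Unique-++⁻ˡ xs ys xs!

Unique-++⁻ʳ : ∀ (xs ys : List A) → Unique (xs ++ ys) → Unique ys
Unique-++⁻ʳ []       ys ys!       = ys!
Unique-++⁻ʳ (x ∷ xs) ys (_ ∷ xs!) = Unique-++⁻ʳ xs ys xs!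

Unique-++⇒disjoint : ∀ {v : A} xs ys → Unique (xs ++ ys) → v ∈ xs → v ∉ ys
Unique-++⇒disjoint (x ∷ xs) ys xs!      (here refl)  v∈ys = Unique[x∷xs]⇒x∉xs xs! (∈-++⁺ʳ xs v∈ys)
Unique-++⇒disjoint (x ∷ xs) ys (_ ∷ xs!) (there v∈xs) v∈ys = Unique-++⇒disjoint xs ys xs! v∈xs v∈ys

module _ {n : ℕ} where

  ∈ᵇ-true : ∀ {v : Fin n} {xs} → v ∈ xs → v ∈ᵇ xs ≡ true
  ∈ᵇ-true {v} {x ∷ xs} v∈ with x ≟ v
  ... | yes _  = refl
  ... | no x≢v = ∈ᵇ-true (tail (x≢v ∘ sym) v∈)

  ∈ᵇ-false : ∀ {v : Fin n} {xs} → v ∉ xs → v ∈ᵇ xs ≡ false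
  ∈ᵇ-false {v} {[]}     _  = refl
  ∈ᵇ-false {v} {x ∷ xs} v∉ with x ≟ v
  ... | yes x≡v = ⊥-elim (v∉ (here (sym x≡v)))
  ... | no _    = ∈ᵇ-false (v∉ ∘ there)

  ∑-δ-absent : ∀ {a : Fin n} {xs} → All (a ≢_) xs → ∑ xs (λ u → 𝟙 ⌊ a ≟ u ⌋ * f u) ≡ 0
  ∑-δ-absent []                       = refl
  ∑-δ-absent {a = a} (_∷_ {x} a≢x a∉) with a ≟ x
  ... | yes a≡x = ⊥-elim (a≢x a≡x)
  ... | no _    = ∑-δ-absent a∉

  ∑-δ : ∀ (a : Fin n) xs → Unique xs → a ∈ xs → ∑ xs (λ u → 𝟙 ⌊ a ≟ u ⌋ * f u) ≡ f a
  ∑-δ {f = f} a (x ∷ xs) (a∉ ∷ xs!) a∈ with a ≟ x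
  ... | yes refl = begin
    f a + 0 + ∑ xs (λ u → 𝟙 ⌊ a ≟ u ⌋ * f u)  ≡⟨ cong₂ _+_ (+-identityʳ (f a)) (∑-δ-absent a∉) ⟩
    f a + 0                                    ≡⟨ +-identityʳ (f a) ⟩
    f a                                        ∎
  ... | no a≢x = ∑-δ a xs xs! (tail a≢x a∈)

  ∑-Unique : ∀ xs → Unique xs → ∑ xs f ≡ ∑ (allFin n) (λ u → 𝟙 (u ∈ᵇ xs) * f u)
  ∑-Unique         []       []         = sym (∑-zero (allFin n))
  ∑-Unique {f = f} (a ∷ xs) (a∉ ∷ xs!) = begin
    f a + ∑ xs f
      ≡⟨ cong₂ _+_ (∑-δ a (allFin n) (allFin⁺ n) (∈-allFin a)) (sym (∑-Unique xs xs!)) ⟨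
    ∑ N (λ u → 𝟙 ⌊ a ≟ u ⌋ * f u) + ∑ N (λ u → 𝟙 (u ∈ᵇ xs) * f u)
      ≡⟨ ∑-+ N ⟨
    ∑ N (λ u → 𝟙 ⌊ a ≟ u ⌋ * f u + 𝟙 (u ∈ᵇ xs) * f u)
      ≡⟨ ∑-cong N merge ⟩
    ∑ N (λ u → 𝟙 (⌊ a ≟ u ⌋ ∨ u ∈ᵇ xs) * f u)
      ∎
    where
    N : List (Fin n)
    N = allFin n
    merge : ∀ u → 𝟙 ⌊ a ≟ u ⌋ * f u + 𝟙 (u ∈ᵇ xs) * f u ≡ 𝟙 (⌊ a ≟ u ⌋ ∨ u ∈ᵇ xs) * f u
    merge u with a ≟ u
    ... | no _     = refl
    ... | yes refl rewrite ∈ᵇ-false (Unique[x∷xs]⇒x∉xs (a∉ ∷ xs!)) = +-identityʳ _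

eqDir-refl : ∀ d → eqDir d d ≡ true
eqDir-refl left  = refl
eqDir-refl right = refl

isPrefix-++ : ∀ p q → isPrefix p (p ++ q) ≡ true
isPrefix-++ []      q = refl
isPrefix-++ (d ∷ p) q rewrite eqDir-refl d = isPrefix-++ p q

isPrefix-refl : ∀ p → isPrefix p p ≡ true
isPrefix-refl p = subst (λ z → isPrefix p z ≡ true) (++-identityʳ p) (isPrefix-++ p [])

isPrefix-++-false : ∀ p s a → isPrefix p a ≡ false → isPrefix (p ++ s) a ≡ false
isPrefix-++-false []      s a       ()
isPrefix-++-false (d ∷ p) s []      _ = refl
isPrefix-++-false (d ∷ p) s (e ∷ a) h with eqDir d e
... | true  = isPrefix-++-false p s a h
... | false = refl

isPrefix-longer : ∀ p d q → isPrefix (p ++ d ∷ q) p ≡ false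
isPrefix-longer []      d q = refl
isPrefix-longer (e ∷ p) d q rewrite eqDir-refl e = isPrefix-longer p d q

isPrefix-fork : ∀ p d e x y → eqDir d e ≡ false → isPrefix (p ++ d ∷ x) (p ++ e ∷ y) ≡ false
isPrefix-fork []      d e x y d≠e rewrite d≠e  = refl
isPrefix-fork (c ∷ p) d e x y d≠e rewrite eqDir-refl c = isPrefix-fork p d e x y d≠e

lcp-++ : ∀ p a b → lcp (p ++ a) (p ++ b) ≡ p ++ lcp a b
lcp-++ []      a b = refl
lcp-++ (d ∷ p) a b rewrite eqDir-refl d = cong (d ∷_) (lcp-++ p a b)

lcp-comm : ∀ a b → lcp a b ≡ lcp b a
lcp-comm []          []          = refl
lcp-comm []          (_ ∷ _)     = refl
lcp-comm (_ ∷ _)     []          = refl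
lcp-comm (left ∷ a)  (left ∷ b)  = cong (left ∷_) (lcp-comm a b)
lcp-comm (left ∷ a)  (right ∷ b) = refl
lcp-comm (right ∷ a) (left ∷ b)  = refl
lcp-comm (right ∷ a) (right ∷ b) = cong (right ∷_) (lcp-comm a b)

isPrefix-lcp-outside : ∀ p q b → isPrefix p b ≡ false → isPrefix (lcp (p ++ q) b) p ≡ true
isPrefix-lcp-outside []          q b           ()
isPrefix-lcp-outside (d ∷ p)     q []          _ = refl
isPrefix-lcp-outside (left ∷ p)  q (left ∷ b)  h rewrite isPrefix-lcp-outside p q b h = refl
isPrefix-lcp-outside (left ∷ p)  q (right ∷ b) _ = refl
isPrefix-lcp-outside (right ∷ p) q (left ∷ b)  _ = refl
isPrefix-lcp-outside (right ∷ p) q (right ∷ b) h rewrite isPrefix-lcp-outside p q b h = refl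

-- onRoute T u v (at p) unfolds to onPath p (posOf T u) (posOf T v).
onPath : Pos → Pos → Pos → Bool
onPath p a b = isPrefix (lcp a b) p ∧ (isPrefix p a ∨ isPrefix p b)

onPath-same-child : ∀ p d x y → onPath p (p ++ d ∷ x) (p ++ d ∷ y) ≡ false
onPath-same-child p d x y
  rewrite lcp-++ p (d ∷ x) (d ∷ y) | eqDir-refl d | isPrefix-longer p d (lcp x y) = refl

onPath-fork : ∀ p d e x y → eqDir d e ≡ false → onPath p (p ++ d ∷ x) (p ++ e ∷ y) ≡ true
onPath-fork p d e x y d≠e
  rewrite lcp-++ p (d ∷ x) (e ∷ y) | d≠e | ++-identityʳ p | isPrefix-refl p | isPrefix-++ p (d ∷ x) = refl

onPath-inside-outside : ∀ p q b → isPrefix p b ≡ false → onPath p (p ++ q) b ≡ true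
onPath-inside-outside p q b h rewrite isPrefix-lcp-outside p q b h | isPrefix-++ p q = refl

onPath-outside-inside : ∀ p a q → isPrefix p a ≡ false → onPath p a (p ++ q) ≡ true
onPath-outside-inside p a q h
  rewrite lcp-comm a (p ++ q) | isPrefix-lcp-outside p q a h | isPrefix-++ p q | h = refl

onPath-outside-outside : ∀ p a b → isPrefix p a ≡ false → isPrefix p b ≡ false → onPath p a b ≡ false
onPath-outside-outside p a b ha hb rewrite ha | hb = ∧-zeroʳ _

onPath-here-outside : ∀ p b → isPrefix p b ≡ false → onPath p p b ≡ true
onPath-here-outside p b h = subst (λ a → onPath p a b ≡ true) (++-identityʳ p) (onPath-inside-outside p [] b h)

onPath-outside-here : ∀ p a → isPrefix p a ≡ false → onPath p a p ≡ true
onPath-outside-here p a h = subst (λ b → onPath p a b ≡ true) (++-identityʳ p) (onPath-outside-inside p a [] h)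

data Side : Set where
  below : Dir → Side
  away  : Side

LiesOn : Pos → Side → Pos → Set
LiesOn p (below d) a = ∃ λ q → a ≡ p ++ d ∷ q
LiesOn p away      a = isPrefix p a ≡ false

separates : Side → Side → Bool
separates (below d) (below e) = not (eqDir d e)
separates (below _) away      = true
separates away      (below _) = true
separates away      away      = false

onPath-sides : ∀ p {s t a b} → LiesOn p s a → LiesOn p t b → onPath p a b ≡ separates s t
onPath-sides p {below left}  {below left}  (x , refl) (y , refl) = onPath-same-child p left x y
onPath-sides p {below left}  {below right} (x , refl) (y , refl) = onPath-fork p left right x y refl
onPath-sides p {below right} {below left}  (x , refl) (y , refl) = onPath-fork p right left x y refl
onPath-sides p {below right} {below right} (x , refl) (y , refl) = onPath-same-child p right x y
onPath-sides p {below d}     {away}        (x , refl) hb         = onPath-inside-outside p (d ∷ x) _ hb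
onPath-sides p {away}        {below e}     ha         (y , refl) = onPath-outside-inside p _ (e ∷ y) ha
onPath-sides p {away}        {away}        ha         hb         = onPath-outside-outside p _ _ ha hb

inLeft inRight : Side → Bool
inLeft (below left) = true
inLeft _            = false
inRight (below right) = true
inRight _             = false

-- Given the flags (u ∈ L, u ∈ R, v ∈ L, v ∈ R) for the leaf sets L, R of two sibling subtrees and
-- the complement C of L ∪ R, this is 1 exactly when (u, v) ∈ L × C, L × R or R × C.
crossing : Bool → Bool → Bool → Bool → ℕ
crossing uL uR vL vR = 𝟙 uL * 𝟙 (not (vL ∨ vR)) + 𝟙 uL * 𝟙 vR + 𝟙 uR * 𝟙 (not (vL ∨ vR))

𝟙-separates : ∀ s t → 𝟙 (separates s t) ≡ crossing (inLeft s) (inRight s) (inLeft t) (inRight t)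
                                          + crossing (inLeft t) (inRight t) (inLeft s) (inRight s)
𝟙-separates (below left)  (below left)  = refl
𝟙-separates (below left)  (below right) = refl
𝟙-separates (below left)  away          = refl
𝟙-separates (below right) (below left)  = refl
𝟙-separates (below right) (below right) = refl
𝟙-separates (below right) away          = refl
𝟙-separates away          (below left)  = refl
𝟙-separates away          (below right) = refl
𝟙-separates away          away          = refl

pathSum : (Pos → ℕ) → Pos → Pos → ℕ
pathSum c p q = ∑ (inits q) (λ q′ → c (p ++ q′))

pathSum-∷ : ∀ c p d q → pathSum c p (d ∷ q) ≡ c p + pathSum c (p ∷ʳ d) q
pathSum-∷ c p d q = cong₂ _+_ (cong c (++-identityʳ p)) (begin
  ∑ (map (d ∷_) (inits q)) (λ q′ → c (p ++ q′))  ≡⟨ ∑-map (d ∷_) (inits q) ⟩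
  ∑ (inits q) (λ q′ → c (p ++ d ∷ q′))           ≡⟨ ∑-cong (inits q) (λ q′ → cong c (++-assoc p _ q′)) ⟨
  pathSum c (p ∷ʳ d) q                           ∎)

module _ {n : ℕ} where

  open import Data.List.Membership.DecPropositional (_≟_ {n}) using (_∈?_)

  maxPathSum : (Pos → ℕ) → CTree n → Pos → ℕ
  maxPathSum c S p = ⨆ (map (λ vq → pathSum c p (proj₂ vq)) (leafPositions S))

  maxPathSum-leaf : ∀ c v p → maxPathSum c (leaf v) p ≡ c p
  maxPathSum-leaf c v p = trans (⊔-identityʳ _) (trans (+-identityʳ _) (cong c (++-identityʳ p)))

  leafPositions-nonempty : ∀ (S : CTree n) → ∃₂ λ vq vqs → leafPositions S ≡ vq ∷ vqs
  leafPositions-nonempty (leaf v)   = _ , _ , refl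
  leafPositions-nonempty (node l r) with leafPositions-nonempty l
  ... | _ , _ , eq rewrite eq = _ , _ , refl

  shift : Dir → Fin n × Pos → Fin n × Pos
  shift d vq = proj₁ vq , d ∷ proj₂ vq

  maxPathSum-shift : ∀ c p d (S : CTree n) →
    ⨆ (map (λ vq → pathSum c p (proj₂ vq)) (map (shift d) (leafPositions S))) ≡ c p + maxPathSum c S (p ∷ʳ d)
  maxPathSum-shift c p d S with leafPositions S | leafPositions-nonempty S
  ... | _ | vq , vqs , refl = begin
    ⨆ (map (λ vq → pathSum c p (proj₂ vq)) (map (shift d) (vq ∷ vqs)))
      ≡⟨ cong ⨆ (map-∘ (vq ∷ vqs)) ⟨
    ⨆ (map (λ vq → pathSum c p (d ∷ proj₂ vq)) (vq ∷ vqs))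
      ≡⟨ cong ⨆ (map-cong (λ vq → pathSum-∷ c p d (proj₂ vq)) (vq ∷ vqs)) ⟩
    ⨆ (map (λ vq → c p + pathSum c (p ∷ʳ d) (proj₂ vq)) (vq ∷ vqs))
      ≡⟨ ⨆-map-+ (c p) _ vq vqs ⟩
    c p + ⨆ (map (λ vq → pathSum c (p ∷ʳ d) (proj₂ vq)) (vq ∷ vqs))
      ∎

  maxPathSum-node : ∀ c l r p →
    maxPathSum c (node l r) p ≡ c p + (maxPathSum c l (p ∷ʳ left) ⊔ maxPathSum c r (p ∷ʳ right))
  maxPathSum-node c l r p = begin
    ⨆ (map F (map (shift left) (leafPositions l) ++ map (shift right) (leafPositions r)))
      ≡⟨ cong ⨆ (map-++ F (map (shift left) (leafPositions l)) _) ⟩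
    ⨆ (map F (map (shift left) (leafPositions l)) ++ map F (map (shift right) (leafPositions r)))
      ≡⟨ ⨆-++ (map F (map (shift left) (leafPositions l))) _ ⟩
    ⨆ (map F (map (shift left) (leafPositions l))) ⊔ ⨆ (map F (map (shift right) (leafPositions r)))
      ≡⟨ cong₂ _⊔_ (maxPathSum-shift c p left l) (maxPathSum-shift c p right r) ⟩
    (c p + maxPathSum c l (p ∷ʳ left)) ⊔ (c p + maxPathSum c r (p ∷ʳ right))
      ≡⟨ +-distribˡ-⊔ (c p) _ _ ⟨
    c p + (maxPathSum c l (p ∷ʳ left) ⊔ maxPathSum c r (p ∷ʳ right))
      ∎
    where
    F : Fin n × Pos → ℕ
    F vq = pathSum c p (proj₂ vq)

  map-proj₁-shift : ∀ d (vqs : List (Fin n × Pos)) → map proj₁ (map (shift d) vqs) ≡ map proj₁ vqs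
  map-proj₁-shift d vqs = sym (map-∘ vqs)

  map-proj₁-leafPositions : ∀ (S : CTree n) → map proj₁ (leafPositions S) ≡ leaves S
  map-proj₁-leafPositions (leaf v)   = refl
  map-proj₁-leafPositions (node l r) = begin
    map proj₁ (map (shift left) (leafPositions l) ++ map (shift right) (leafPositions r))
      ≡⟨ map-++ proj₁ (map (shift left) (leafPositions l)) _ ⟩
    map proj₁ (map (shift left) (leafPositions l)) ++ map proj₁ (map (shift right) (leafPositions r))
      ≡⟨ cong₂ _++_ (trans (map-proj₁-shift left _) (map-proj₁-leafPositions l))
                    (trans (map-proj₁-shift right _) (map-proj₁-leafPositions r)) ⟩
    leaves l ++ leaves r
      ∎

  lookupPos-++ˡ : ∀ {v} (vqs vqs′ : List (Fin n × Pos)) → v ∈ map proj₁ vqs →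
                  lookupPos (vqs ++ vqs′) v ≡ lookupPos vqs v
  lookupPos-++ˡ {v} ((u , q) ∷ vqs) vqs′ v∈ with u ≟ v
  ... | yes _  = refl
  ... | no u≢v = lookupPos-++ˡ vqs vqs′ (tail (u≢v ∘ sym) v∈)

  lookupPos-++ʳ : ∀ {v} (vqs vqs′ : List (Fin n × Pos)) → v ∉ map proj₁ vqs →
                  lookupPos (vqs ++ vqs′) v ≡ lookupPos vqs′ v
  lookupPos-++ʳ         []               vqs′ v∉ = refl
  lookupPos-++ʳ {v} ((u , q) ∷ vqs) vqs′ v∉ with u ≟ v
  ... | yes u≡v = ⊥-elim (v∉ (here (sym u≡v)))
  ... | no _    = lookupPos-++ʳ vqs vqs′ (v∉ ∘ there)

  lookupPos-shift : ∀ {v} d (vqs : List (Fin n × Pos)) → v ∈ map proj₁ vqs →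
                    lookupPos (map (shift d) vqs) v ≡ d ∷ lookupPos vqs v
  lookupPos-shift {v} d ((u , q) ∷ vqs) v∈ with u ≟ v
  ... | yes _  = refl
  ... | no u≢v = lookupPos-shift d vqs (tail (u≢v ∘ sym) v∈)

  lookupPos-node-left : ∀ {v} l (r : CTree n) → v ∈ leaves l →
    lookupPos (leafPositions (node l r)) v ≡ left ∷ lookupPos (leafPositions l) v
  lookupPos-node-left {v} l r v∈l = begin
    lookupPos (map (shift left) (leafPositions l) ++ map (shift right) (leafPositions r)) v
      ≡⟨ lookupPos-++ˡ _ _ (subst (v ∈_) (sym (map-proj₁-shift left _)) v∈positions) ⟩
    lookupPos (map (shift left) (leafPositions l)) v
      ≡⟨ lookupPos-shift left _ v∈positions ⟩
    left ∷ lookupPos (leafPositions l) v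
      ∎
    where
    v∈positions : v ∈ map proj₁ (leafPositions l)
    v∈positions = subst (v ∈_) (sym (map-proj₁-leafPositions l)) v∈l

  lookupPos-node-right : ∀ {v} l (r : CTree n) → v ∉ leaves l → v ∈ leaves r →
    lookupPos (leafPositions (node l r)) v ≡ right ∷ lookupPos (leafPositions r) v
  lookupPos-node-right {v} l r v∉l v∈r = begin
    lookupPos (map (shift left) (leafPositions l) ++ map (shift right) (leafPositions r)) v
      ≡⟨ lookupPos-++ʳ _ _ v∉positions ⟩
    lookupPos (map (shift right) (leafPositions r)) v
      ≡⟨ lookupPos-shift right _ (subst (v ∈_) (sym (map-proj₁-leafPositions r)) v∈r) ⟩
    right ∷ lookupPos (leafPositions r) v
      ∎
    where
    v∉positions : v ∉ map proj₁ (map (shift left) (leafPositions l))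
    v∉positions = subst (v ∉_) (sym (trans (map-proj₁-shift left _) (map-proj₁-leafPositions l))) v∉l

  -- pos puts every leaf of S where it would be if S were the subtree at position p.
  Placed : (Fin n → Pos) → CTree n → Pos → Set
  Placed pos (leaf v)   p = pos v ≡ p
  Placed pos (node l r) p = Placed pos l (p ∷ʳ left) × Placed pos r (p ∷ʳ right)

  Outside : (Fin n → Pos) → CTree n → Pos → Set
  Outside pos S p = ∀ v → v ∉ leaves S → isPrefix p (pos v) ≡ false

  placed-∈ : ∀ {pos} S {p v} → Placed pos S p → v ∈ leaves S → ∃ λ q → pos v ≡ p ++ q
  placed-∈ (leaf x) {p} pos≡ (here refl) = [] , trans pos≡ (sym (++-identityʳ p))
  placed-∈ (node l r) {p} (placed-l , placed-r) v∈ with ∈-++⁻ (leaves l) v∈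
  ... | inj₁ v∈l = let q , eq = placed-∈ l placed-l v∈l in left ∷ q , trans eq (++-assoc p _ q)
  ... | inj₂ v∈r = let q , eq = placed-∈ r placed-r v∈r in right ∷ q , trans eq (++-assoc p _ q)

  placed-lookupPos : ∀ pos (S : CTree n) p → Unique (leaves S) →
    (∀ v → v ∈ leaves S → pos v ≡ p ++ lookupPos (leafPositions S) v) → Placed pos S p
  placed-lookupPos pos (leaf x) p _ pos≡ with x ≟ x | pos≡ x (here refl)
  ... | yes _  | eq = trans eq (++-identityʳ p)
  ... | no x≢x | _  = ⊥-elim (x≢x refl)
  placed-lookupPos pos (node l r) p lr! pos≡ =
    placed-lookupPos pos l _ (Unique-++⁻ˡ (leaves l) _ lr!) pos≡l ,
    placed-lookupPos pos r _ (Unique-++⁻ʳ (leaves l) _ lr!) pos≡r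
    where
    pos≡l : ∀ v → v ∈ leaves l → pos v ≡ (p ∷ʳ left) ++ lookupPos (leafPositions l) v
    pos≡l v v∈l = begin
      pos v                                             ≡⟨ pos≡ v (∈-++⁺ˡ v∈l) ⟩
      p ++ lookupPos (leafPositions (node l r)) v       ≡⟨ cong (p ++_) (lookupPos-node-left l r v∈l) ⟩
      p ++ left ∷ lookupPos (leafPositions l) v         ≡⟨ ++-assoc p _ _ ⟨
      (p ∷ʳ left) ++ lookupPos (leafPositions l) v      ∎
    pos≡r : ∀ v → v ∈ leaves r → pos v ≡ (p ∷ʳ right) ++ lookupPos (leafPositions r) v
    pos≡r v v∈r = begin
      pos v                                             ≡⟨ pos≡ v (∈-++⁺ʳ (leaves l) v∈r) ⟩
      p ++ lookupPos (leafPositions (node l r)) v       ≡⟨ cong (p ++_) (lookupPos-node-right l r v∉l v∈r) ⟩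
      p ++ right ∷ lookupPos (leafPositions r) v        ≡⟨ ++-assoc p _ _ ⟨
      (p ∷ʳ right) ++ lookupPos (leafPositions r) v     ∎
      where
      v∉l : v ∉ leaves l
      v∉l v∈l = Unique-++⇒disjoint (leaves l) (leaves r) lr! v∈l v∈r

  outside-child : ∀ {pos} d e (S S′ : CTree n) p → eqDir d e ≡ false → Placed pos S′ (p ∷ʳ e) →
    (∀ v → v ∉ leaves S → v ∉ leaves S′ → isPrefix p (pos v) ≡ false) → Outside pos S (p ∷ʳ d)
  outside-child {pos} d e S S′ p d≠e placed′ out v v∉S with v ∈? leaves S′
  ... | no v∉S′  = isPrefix-++-false p _ (pos v) (out v v∉S v∉S′)
  ... | yes v∈S′ with placed-∈ S′ placed′ v∈S′
  ...   | q , eq rewrite eq | ++-assoc p (e ∷ []) q = isPrefix-fork p d e [] q d≠e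

  outside-left : ∀ {pos} l r p → Placed pos r (p ∷ʳ right) → Outside pos (node l r) p →
                 Outside pos l (p ∷ʳ left)
  outside-left l r p placed-r out =
    outside-child left right l r p refl placed-r (λ v v∉l v∉r → out v (∉-++ (leaves l) _ v∉l v∉r))

  outside-right : ∀ {pos} l r p → Placed pos l (p ∷ʳ left) → Outside pos (node l r) p →
                  Outside pos r (p ∷ʳ right)
  outside-right l r p placed-l out =
    outside-child right left r l p refl placed-l (λ v v∉r v∉l → out v (∉-++ (leaves l) _ v∉l v∉r))

  side-in-node : ∀ {pos} l r p → Unique (leaves l ++ leaves r) →
    Placed pos l (p ∷ʳ left) → Placed pos r (p ∷ʳ right) → Outside pos (node l r) p →
    ∀ x → ∃ λ s → LiesOn p s (pos x) × x ∈ᵇ leaves l ≡ inLeft s × x ∈ᵇ leaves r ≡ inRight s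
  side-in-node l r p lr! placed-l placed-r out x with x ∈? leaves l | x ∈? leaves r
  ... | yes x∈l | yes x∈r = ⊥-elim (Unique-++⇒disjoint (leaves l) _ lr! x∈l x∈r)
  ... | yes x∈l | no x∉r  =
    let q , eq = placed-∈ l placed-l x∈l
    in  below left , (q , trans eq (++-assoc p _ q)) , ∈ᵇ-true x∈l , ∈ᵇ-false x∉r
  ... | no x∉l  | yes x∈r =
    let q , eq = placed-∈ r placed-r x∈r
    in  below right , (q , trans eq (++-assoc p _ q)) , ∈ᵇ-false x∉l , ∈ᵇ-true x∈r
  ... | no x∉l  | no x∉r  = away , out x (∉-++ (leaves l) _ x∉l x∉r) , ∈ᵇ-false x∉l , ∈ᵇ-false x∉r

module Congestion {n : ℕ} (G : WGraph n) (T : CTree n) where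
  open WGraph G

  N : List (Fin n)
  N = allFin n

  pos : Fin n → Pos
  pos = posOf T

  ∑∑ : (Fin n → Fin n → ℕ) → ℕ
  ∑∑ h = ∑ N (λ u → ∑ N (h u))

  ∑∑-cong : ∀ {h h′ : Fin n → Fin n → ℕ} → (∀ u v → h u v ≡ h′ u v) → ∑∑ h ≡ ∑∑ h′
  ∑∑-cong h≗h′ = ∑-cong N (λ u → ∑-cong N (h≗h′ u))

  ∑∑-+ : ∀ (h h′ : Fin n → Fin n → ℕ) → ∑∑ (λ u v → h u v + h′ u v) ≡ ∑∑ h + ∑∑ h′
  ∑∑-+ h h′ = trans (∑-cong N (λ u → ∑-+ N)) (∑-+ N)

  lt : Fin n → Fin n → Bool
  lt u v = does (toℕ u <? toℕ v)

  ∑-pairs : ∀ (h : Fin n × Fin n → ℕ) → ∑ (pairs n) h ≡ ∑∑ (λ u v → if lt u v then h (u , v) else 0)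
  ∑-pairs h =
    trans (∑-filter (λ uv → toℕ (proj₁ uv) <? toℕ (proj₂ uv)) (concatMap (λ u → map (u ,_) N) N))
    (trans (∑-concatMap (λ u → map (u ,_) N) N)
           (∑-cong N (λ u → ∑-map (u ,_) N)))

  lt-trichotomy : ∀ u v k → (u ≡ v → k ≡ 0) → (if lt u v then k else 0) + (if lt v u then k else 0) ≡ k
  lt-trichotomy u v k diagonal with <-cmp (toℕ u) (toℕ v)
  ... | tri< u<v _ v≮u
    rewrite dec-true (toℕ u <? toℕ v) u<v | dec-false (toℕ v <? toℕ u) v≮u = +-identityʳ k
  ... | tri≈ u≮v u≡v v≮u
    rewrite dec-false (toℕ u <? toℕ v) u≮v | dec-false (toℕ v <? toℕ u) v≮u = sym (diagonal (toℕ-injective u≡v))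
  ... | tri> u≮v _ v<u
    rewrite dec-false (toℕ u <? toℕ v) u≮v | dec-true (toℕ v <? toℕ u) v<u = refl

  ∑∑-symmetrize : ∀ (g : Fin n → Fin n → ℕ) →
    ∑∑ (λ u v → if lt u v then (g u v + g v u) * w u v else 0) ≡ ∑∑ (λ u v → g u v * w u v)
  ∑∑-symmetrize g = begin
    ∑∑ (λ u v → if lt u v then (g u v + g v u) * w u v else 0)
      ≡⟨ ∑∑-cong split ⟩
    ∑∑ (λ u v → forward u v + backward u v)
      ≡⟨ ∑∑-+ forward backward ⟩
    ∑∑ forward + ∑∑ backward
      ≡⟨ cong (∑∑ forward +_) (∑-comm backward N N) ⟩
    ∑∑ forward + ∑∑ (λ u v → backward v u)
      ≡⟨ cong (∑∑ forward +_) (∑∑-cong (λ u v → cong (λ k → if lt v u then g u v * k else 0) (w-sym v u))) ⟩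
    ∑∑ forward + ∑∑ (λ u v → if lt v u then g u v * w u v else 0)
      ≡⟨ ∑∑-+ forward _ ⟨
    ∑∑ (λ u v → forward u v + (if lt v u then g u v * w u v else 0))
      ≡⟨ ∑∑-cong (λ u v → lt-trichotomy u v (g u v * w u v) (diagonal u v)) ⟩
    ∑∑ (λ u v → g u v * w u v)
      ∎
    where
    forward backward : Fin n → Fin n → ℕ
    forward  u v = if lt u v then g u v * w u v else 0
    backward u v = if lt u v then g v u * w u v else 0
    split : ∀ u v → (if lt u v then (g u v + g v u) * w u v else 0) ≡ forward u v + backward u v
    split u v with lt u v
    ... | true  = *-distribʳ-+ (w u v) (g u v) (g v u)
    ... | false = refl
    diagonal : ∀ u v → u ≡ v → g u v * w u v ≡ 0
    diagonal u .u refl = trans (cong (g u u *_) (w-loop u)) (*-zeroʳ (g u u))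

  con-rootLeaf : con w T rootLeaf ≡ 0
  con-rootLeaf = ∑-zero (pairs n)

  con-at : ∀ p (g : Fin n → Fin n → ℕ) →
    (∀ u v → (if onPath p (pos u) (pos v) then w u v else 0) ≡ (g u v + g v u) * w u v) →
    con w T (at p) ≡ ∑∑ (λ u v → g u v * w u v)
  con-at p g routed = begin
    con w T (at p)
      ≡⟨ ∑-pairs _ ⟩
    ∑∑ (λ u v → if lt u v then (if onPath p (pos u) (pos v) then w u v else 0) else 0)
      ≡⟨ ∑∑-cong (λ u v → cong (λ k → if lt u v then k else 0) (routed u v)) ⟩
    ∑∑ (λ u v → if lt u v then (g u v + g v u) * w u v else 0)
      ≡⟨ ∑∑-symmetrize g ⟩
    ∑∑ (λ u v → g u v * w u v)
      ∎

  cost-leaf : ∀ x p → pos x ≡ p → Outside pos (leaf x) p → entries w x ≡ 2 ^ con w T (at p)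
  cost-leaf x p pos≡ out = begin
    product (map (λ u → 2 ^ w x u) N)                 ≡⟨ product-2^ N ⟩
    2 ^ ∑ N (w x)                                     ≡⟨ cong (2 ^_) (∑-δ x N (allFin⁺ n) (∈-allFin x)) ⟨
    2 ^ ∑ N (λ u → 𝟙 ⌊ x ≟ u ⌋ * ∑ N (w u))          ≡⟨ cong (2 ^_) (∑-cong N (λ u → ∑-*ˡ (𝟙 ⌊ x ≟ u ⌋) N)) ⟨
    2 ^ ∑∑ (λ u v → 𝟙 ⌊ x ≟ u ⌋ * w u v)             ≡⟨ cong (2 ^_) (con-at p (λ u _ → 𝟙 ⌊ x ≟ u ⌋) routed) ⟨
    2 ^ con w T (at p)                                ∎
    where
    away-from : ∀ v → x ≢ v → isPrefix p (pos v) ≡ false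
    away-from v x≢v = out v λ { (here v≡x) → x≢v (sym v≡x) }
    routed : ∀ u v → (if onPath p (pos u) (pos v) then w u v else 0) ≡ (𝟙 ⌊ x ≟ u ⌋ + 𝟙 ⌊ x ≟ v ⌋) * w u v
    routed u v with x ≟ u | x ≟ v
    ... | yes refl | yes refl rewrite w-loop x = if-eta (onPath p (pos x) (pos x))
    ... | yes refl | no x≢v
      rewrite pos≡ | onPath-here-outside p (pos v) (away-from v x≢v) = sym (+-identityʳ _)
    ... | no x≢u   | yes refl
      rewrite pos≡ | onPath-outside-here p (pos u) (away-from u x≢u) = sym (+-identityʳ _)
    ... | no x≢u   | no x≢v
      rewrite onPath-outside-outside p _ _ (away-from u x≢u) (away-from v x≢v) = refl

  Indicates : (Fin n → ℕ) → List (Fin n) → Set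
  Indicates χ X = ∀ (f : Fin n → ℕ) → ∑ X f ≡ ∑ N (λ u → χ u * f u)

  W : List (Fin n) → List (Fin n) → ℕ
  W X Y = ∑ X (λ u → ∑ Y (w u))

  dim≡2^W : ∀ X Y → dim w X Y ≡ 2 ^ W X Y
  dim≡2^W []      Y = refl
  dim≡2^W (u ∷ X) Y = begin
    product (map (λ v → 2 ^ w u v) Y ++ concatMap (λ a → map (λ b → 2 ^ w a b) Y) X)
      ≡⟨ product-++ (map (λ v → 2 ^ w u v) Y) _ ⟩
    product (map (λ v → 2 ^ w u v) Y) * dim w X Y
      ≡⟨ cong₂ _*_ (product-2^ Y) (dim≡2^W X Y) ⟩
    2 ^ ∑ Y (w u) * 2 ^ W X Y
      ≡⟨ ^-distribˡ-+-* 2 (∑ Y (w u)) (W X Y) ⟨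
    2 ^ W (u ∷ X) Y
      ∎

  W-indicator : ∀ X Y χX χY → Indicates χX X → Indicates χY Y → W X Y ≡ ∑∑ (λ u v → χX u * (χY v * w u v))
  W-indicator X Y χX χY χX-X χY-Y = begin
    ∑ X (λ u → ∑ Y (w u))                       ≡⟨ χX-X _ ⟩
    ∑ N (λ u → χX u * ∑ Y (w u))                ≡⟨ ∑-cong N (λ u → cong (χX u *_) (χY-Y (w u))) ⟩
    ∑ N (λ u → χX u * ∑ N (λ v → χY v * w u v)) ≡⟨ ∑-cong N (λ u → ∑-*ˡ (χX u) N) ⟨
    ∑∑ (λ u v → χX u * (χY v * w u v))          ∎

  cost-node : ∀ l r p → Unique (leaves l ++ leaves r) →
    Placed pos l (p ∷ʳ left) → Placed pos r (p ∷ʳ right) → Outside pos (node l r) p →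
    matmulCost w l r ≡ 2 ^ con w T (at p)
  cost-node l r p lr! placed-l placed-r out = begin
    dim w L C * dim w L R * dim w R C
      ≡⟨ cong₂ _*_ (cong₂ _*_ (dim≡2^W L C) (dim≡2^W L R)) (dim≡2^W R C) ⟩
    2 ^ W L C * 2 ^ W L R * 2 ^ W R C
      ≡⟨ cong (_* 2 ^ W R C) (^-distribˡ-+-* 2 (W L C) (W L R)) ⟨
    2 ^ (W L C + W L R) * 2 ^ W R C
      ≡⟨ ^-distribˡ-+-* 2 (W L C + W L R) (W R C) ⟨
    2 ^ (W L C + W L R + W R C)
      ≡⟨ cong (2 ^_) exponent ⟩
    2 ^ con w T (at p)
      ∎
    where
    L R C : List (Fin n)
    L = leaves l
    R = leaves r
    C = filter (λ c → ¬? ((c ∈ᵇ L ∨ c ∈ᵇ R) Bool.≟ true)) N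

    χL χR χC : Fin n → ℕ
    χL u = 𝟙 (u ∈ᵇ L)
    χR u = 𝟙 (u ∈ᵇ R)
    χC u = 𝟙 (not (u ∈ᵇ L ∨ u ∈ᵇ R))

    χL-L : Indicates χL L
    χL-L f = ∑-Unique L (Unique-++⁻ˡ L R lr!)

    χR-R : Indicates χR R
    χR-R f = ∑-Unique R (Unique-++⁻ʳ L R lr!)

    χC-C : Indicates χC C
    χC-C f = trans (∑-filter _ N) (∑-cong N (λ u → complement (u ∈ᵇ L ∨ u ∈ᵇ R) (f u)))
      where
      complement : ∀ b k → (if does (¬? (b Bool.≟ true)) then k else 0) ≡ 𝟙 (not b) * k
      complement true  k = refl
      complement false k = sym (*-identityˡ k)

    side : ∀ x → ∃ λ s → LiesOn p s (pos x) × x ∈ᵇ L ≡ inLeft s × x ∈ᵇ R ≡ inRight s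
    side = side-in-node l r p lr! placed-l placed-r out

    cross : Fin n → Fin n → ℕ
    cross u v = crossing (u ∈ᵇ L) (u ∈ᵇ R) (v ∈ᵇ L) (v ∈ᵇ R)

    routed : ∀ u v → (if onPath p (pos u) (pos v) then w u v else 0) ≡ (cross u v + cross v u) * w u v
    routed u v with side u | side v
    ... | s , u-on , uL , uR | t , v-on , vL , vR rewrite uL | uR | vL | vR | onPath-sides p u-on v-on =
      trans (if-then-0≡𝟙* (separates s t) (w u v)) (cong (_* w u v) (𝟙-separates s t))

    open +-*-Solver using (solve; _:+_; _:*_; _:=_)

    distribute : ∀ a c b a′ k → (a * c + a * b + a′ * c) * k ≡ a * (c * k) + a * (b * k) + a′ * (c * k)
    distribute = solve 5 (λ a c b a′ k →
      (a :* c :+ a :* b :+ a′ :* c) :* k := a :* (c :* k) :+ a :* (b :* k) :+ a′ :* (c :* k)) refl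

    exponent : W L C + W L R + W R C ≡ con w T (at p)
    exponent = begin
      W L C + W L R + W R C
        ≡⟨ cong₂ _+_ (cong₂ _+_ (W-indicator L C χL χC χL-L χC-C) (W-indicator L R χL χR χL-L χR-R))
                     (W-indicator R C χR χC χR-R χC-C) ⟩
      ∑∑ LC + ∑∑ LR + ∑∑ RC
        ≡⟨ cong (_+ ∑∑ RC) (∑∑-+ LC LR) ⟨
      ∑∑ (λ u v → LC u v + LR u v) + ∑∑ RC
        ≡⟨ ∑∑-+ (λ u v → LC u v + LR u v) RC ⟨
      ∑∑ (λ u v → LC u v + LR u v + RC u v)
        ≡⟨ ∑∑-cong (λ u v → distribute (χL u) (χC v) (χR v) (χR u) (w u v)) ⟨
      ∑∑ (λ u v → cross u v * w u v)
        ≡⟨ con-at p cross routed ⟨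
      con w T (at p)
        ∎
      where
      LC LR RC : Fin n → Fin n → ℕ
      LC u v = χL u * (χC v * w u v)
      LR u v = χL u * (χR v * w u v)
      RC u v = χR u * (χC v * w u v)

  vertexCost : Pos → ℕ
  vertexCost q = 2 ^ con w T (at q)

  finishTime≡maxPathSum : ∀ S p → Unique (leaves S) → Placed pos S p → Outside pos S p →
                          finishTime w S ≡ maxPathSum vertexCost S p
  finishTime≡maxPathSum (leaf x) p _ placed out =
    trans (cost-leaf x p placed out) (sym (maxPathSum-leaf vertexCost x p))
  finishTime≡maxPathSum (node l r) p lr! (placed-l , placed-r) out = begin
    matmulCost w l r + (finishTime w l ⊔ finishTime w r)
      ≡⟨ cong₂ _+_ (cost-node l r p lr! placed-l placed-r out)
                   (cong₂ _⊔_ (finishTime≡maxPathSum l _ (Unique-++⁻ˡ (leaves l) _ lr!) placed-l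
                                  (outside-left l r p placed-r out))
                              (finishTime≡maxPathSum r _ (Unique-++⁻ʳ (leaves l) _ lr!) placed-r
                                  (outside-right l r p placed-l out))) ⟩
    vertexCost p + (maxPathSum vertexCost l (p ∷ʳ left) ⊔ maxPathSum vertexCost r (p ∷ʳ right))
      ≡⟨ maxPathSum-node vertexCost l r p ⟨
    maxPathSum vertexCost (node l r) p
      ∎

  weightedHeight≡maxPathSum : weightedHeight w T ≡ maxPathSum vertexCost T [] + 1
  weightedHeight≡maxPathSum rewrite con-rootLeaf = foldr-⊔-1+ _ (leafPositions T)

  parallelTime≡weightedHeight : IsContractionTree T → parallelTime w T ≡ weightedHeight w T
  parallelTime≡weightedHeight T↭ = begin
    finishTime w T + 1                 ≡⟨ cong (_+ 1) (finishTime≡maxPathSum T [] T! placed outside) ⟩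
    maxPathSum vertexCost T [] + 1     ≡⟨ weightedHeight≡maxPathSum ⟨
    weightedHeight w T                 ∎
    where
    T! : Unique (leaves T)
    T! = Permutationₛ.Unique-resp-↭ (setoid (Fin n)) (↭⇒↭ₛ (↭-sym T↭)) (allFin⁺ n)
    placed : Placed pos T []
    placed = placed-lookupPos pos T [] T! (λ _ _ → refl)
    outside : Outside pos T []
    outside v v∉T = ⊥-elim (v∉T (∈-resp-↭ (↭-sym T↭) (∈-allFin v)))

theorem2 : ∀ {n} (G : WGraph n) →
    ((T : CTree n) → IsContractionTree T →
       Σ (CTree n) (λ T' → IsContractionTree T' ×
         (parallelTime (WGraph.w G) T' ≤ weightedHeight (WGraph.w G) T)))
    ×
    ((T : CTree n) → IsContractionTree T →
       Σ (CTree n) (λ T' → IsContractionTree T' ×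
         (weightedHeight (WGraph.w G) T' ≤ parallelTime (WGraph.w G) T)))
theorem2 G =
  (λ T T↭ → T , T↭ , ≤-reflexive (Congestion.parallelTime≡weightedHeight G T T↭)) ,
  (λ T T↭ → T , T↭ , ≤-reflexive (sym (Congestion.parallelTime≡weightedHeight G T T↭)))
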